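{- Let $\Gamma$ be a finite, simple, connected, undirected graph of valency $k\ge 2$ and $G\le\mathrm{Aut}(\Gamma)$ such that $\Gamma$ is $(G,2)$-distance-transitive. If $\gcd(b_1,k)=1$ and $c_2 \mid k$, then $\Gamma$ is $(G,2)$-geodesic-transitive. In particular, if $\gcd(b_1,k)=1$ and $\gcd(b_1,c_2)=1$, then $\Gamma$ is $(G,2)$-geodesic-transitive.
   Context: $\Gamma$ is $(G,2)$-distance-transitive if it has diameter at least $2$, $G$ is vertex-transitive, and each $G_u$ is transitive on the vertices at distance $1$ and at distance $2$ from $u$. For a vertex $u$, $v$ adjacent to $u$ and $w$ at distance $2$ from $u$: $b_1$ is the number of neighbours of $v$ at distance $2$ from $u$, and $c_2$ is the number of neighbours of $w$ adjacent to $u$ (these do not depend on the choices). A $2$-geodesic is a triple $(u,v,w)$ with $u\sim v\sim w$, $u\ne w$, $u\not\sim w$; $\Gamma$ is $(G,2)$-geodesic-transitive if it is $G$-arc-transitive, non-complete, and $G$ is transitive on $2$-geodesics. -}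

module Defs where

open import Data.Nat using (ℕ; zero; suc; _≤_)
open import Data.Bool using (Bool; true; false; _∧_; _∨_; not; if_then_else_)
open import Data.Fin using (Fin; zero; suc; _≟_)
open import Data.Fin.Permutation using (Permutation′; _⟨$⟩ʳ_; id; flip; _∘ₚ_)
open import Data.Product using (Σ; ∃; _×_; _,_)
open import Relation.Nullary using (¬_)
open import Relation.Nullary.Decidable using (⌊_⌋)
open import Relation.Binary.PropositionalEquality using (_≡_)

anyF : ∀ {n} → (Fin n → Bool) → Bool
anyF {zero}  p = false
anyF {suc n} p = p zero ∨ anyF (λ i → p (suc i))

countF : ∀ {n} → (Fin n → Bool) → ℕ
countF {zero}  p = 0
countF {suc n} p = (if p zero then 1 else 0) Data.Nat.+ countF (λ i → p (suc i))

record Graph (n : ℕ) : Set where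
  field
    adj     : Fin n → Fin n → Bool
    symm    : ∀ u v → adj u v ≡ adj v u
    irrefl  : ∀ u → adj u u ≡ false

module _ {n : ℕ} (Γ : Graph n) where
  open Graph Γ

  Adj : Fin n → Fin n → Set
  Adj u v = adj u v ≡ true

  within : ℕ → Fin n → Fin n → Bool
  within zero    u w = ⌊ u ≟ w ⌋
  within (suc m) u w = within m u w ∨ anyF (λ x → within m u x ∧ adj x w)

  atDist : ℕ → Fin n → Fin n → Bool
  atDist zero    u w = within zero u w
  atDist (suc m) u w = within (suc m) u w ∧ not (within m u w)

  Dist : ℕ → Fin n → Fin n → Set
  Dist i u w = atDist i u w ≡ true

  Connected : Set
  Connected = ∀ u w → ∃ λ m → within m u w ≡ true

  Regular : ℕ → Set
  Regular k = ∀ u → countF (adj u) ≡ k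

  DiamAtLeast2 : Set
  DiamAtLeast2 = ∃ λ u → ∃ λ w → within 1 u w ≡ false

  NonComplete : Set
  NonComplete = ∃ λ u → ∃ λ w → ¬ (u ≡ w) × ¬ Adj u w

  IsAut : Permutation′ n → Set
  IsAut g = ∀ u v → adj (g ⟨$⟩ʳ u) (g ⟨$⟩ʳ v) ≡ adj u v

  IsB1 : ℕ → Set
  IsB1 b = ∀ u v → Adj u v → countF (λ w → adj v w ∧ atDist 2 u w) ≡ b

  IsC2 : ℕ → Set
  IsC2 c = ∀ u w → Dist 2 u w → countF (λ x → adj w x ∧ adj u x) ≡ c

record PermGroup (n : ℕ) : Set₁ where
  field
    _∈G    : Permutation′ n → Set
    id∈    : id ∈G
    comp∈  : ∀ g h → g ∈G → h ∈G → (g ∘ₚ h) ∈G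
    inv∈   : ∀ g → g ∈G → flip g ∈G

module _ {n : ℕ} (Γ : Graph n) (G : PermGroup n) where
  open Graph Γ
  open PermGroup G

  SubgroupOfAut : Set
  SubgroupOfAut = ∀ g → g ∈G → IsAut Γ g

  VertexTransitive : Set
  VertexTransitive = ∀ u v → ∃ λ g → g ∈G × g ⟨$⟩ʳ u ≡ v

  LocallyDistTransitive : ℕ → Set
  LocallyDistTransitive i = ∀ u v w → Dist Γ i u v → Dist Γ i u w →
    ∃ λ g → g ∈G × g ⟨$⟩ʳ u ≡ u × g ⟨$⟩ʳ v ≡ w

  TwoDistanceTransitive : Set
  TwoDistanceTransitive = DiamAtLeast2 Γ × VertexTransitive ×
    LocallyDistTransitive 1 × LocallyDistTransitive 2

  ArcTransitive : Set
  ArcTransitive = ∀ u v u′ v′ → Adj Γ u v → Adj Γ u′ v′ →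
    ∃ λ g → g ∈G × g ⟨$⟩ʳ u ≡ u′ × g ⟨$⟩ʳ v ≡ v′

  Geodesic2 : Fin n → Fin n → Fin n → Set
  Geodesic2 u v w = Adj Γ u v × Adj Γ v w × ¬ (u ≡ w) × ¬ Adj Γ u w

  TwoGeodesicTransitive : Set
  TwoGeodesicTransitive = ArcTransitive × NonComplete Γ ×
    (∀ u v w u′ v′ w′ → Geodesic2 u v w → Geodesic2 u′ v′ w′ →
      ∃ λ g → g ∈G × g ⟨$⟩ʳ u ≡ u′ × g ⟨$⟩ʳ v ≡ v′ × g ⟨$⟩ʳ w ≡ w′)

{-# OPTIONS --safe #-}
-- Fix u and let O be the orbit of one 2-geodesic (u, v₀, w₀) under the stabiliser G_u.
-- As G_u is transitive on Γ(u) and on Γ₂(u), every v ∈ Γ(u) starts the same number m₁ of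
-- members of O and every w ∈ Γ₂(u) ends the same number m₂, so k m₁ = k₂ m₂ with
-- k₂ = |Γ₂(u)|; counting all 2-geodesics from u the same way gives k b₁ = k₂ c₂.  Hence
-- c₂ m₁ = b₁ m₂, and when b₁ and c₂ are coprime, b₁ divides m₁ ≤ b₁: the orbit contains
-- every 2-geodesic through the arc (u, v₀).  Together with arc-transitivity this is
-- transitivity on 2-geodesics.  Both hypotheses of the theorem make b₁ and c₂ coprime.
--
-- G is only given by a membership predicate, so O cannot be enumerated directly; instead it
-- is the closure of (v₀, w₀) under finitely many elements of G_u that carry v₀ (resp. w₀) to
-- every other vertex at distance 1 (resp. 2) from u.  The closure is reached after finitely
-- many steps because an ascending chain of subsets of a finite set stabilises.
module Submission where

open import Defs
open import Data.Nat using (ℕ; zero; suc; _+_; _*_; _≤_; _<_; z≤n; s≤s; >-nonZero)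
open import Data.Nat.Properties
  using ( ≤-refl; ≤-trans; ≤-antisym; <-irrefl; 1+n≰n; n≤0⇒n≡0; m≤n⇒m<n∨m≡n; m≤m+n; m≤n+m
        ; +-mono-≤; +-mono-<-≤; +-cancelˡ-≡; *-identityʳ; *-comm; *-assoc; *-cancelˡ-≡
        ; +-0-commutativeMonoid )
open import Data.Nat.Divisibility using (_∣_; divides; ∣-trans; ∣⇒≤)
open import Data.Nat.GCD using (gcd)
open import Data.Nat.Coprimality using (Coprime; coprime-divisor; gcd≡1⇒coprime)
open import Algebra.Properties.CommutativeMonoid.Sum +-0-commutativeMonoid
  using (sum-syntax; ∑-comm; ∑-permute; sum-cong-≗)
open import Data.Bool using (Bool; true; false; _∧_; _∨_; not; if_then_else_)
open import Data.Bool.Properties using (∧-conicalˡ; ∧-conicalʳ; ∧-identityʳ; ∧-comm; ¬-not; ⇔→≡)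
open import Data.Fin using (Fin; zero; suc; _≟_; _↑ˡ_; _↑ʳ_; splitAt; combine; remQuot)
open import Data.Fin.Properties using (splitAt-↑ˡ; splitAt-↑ʳ; remQuot-combine)
open import Data.Fin.Permutation
  using (Permutation′; _⟨$⟩ʳ_; _⟨$⟩ˡ_; inverseˡ; inverseʳ; id; flip; _∘ₚ_)
open import Data.Product using (∃; _×_; _,_; proj₁; proj₂; uncurry)
open import Data.Sum using (_⊎_; inj₁; inj₂; fromInj₁)
open import Data.Empty using (⊥-elim)
open import Function using (_∘_; case_of_; mk⇔)
open import Relation.Nullary using (¬_)
open import Relation.Nullary.Decidable
  using (⌊_⌋; does; yes; no; isYes≗does; dec-true; dec-false; does-⇔)
open import Relation.Binary.PropositionalEquality

∨-introˡ : ∀ {a} b → a ≡ true → a ∨ b ≡ true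
∨-introˡ b refl = refl

∨-introʳ : ∀ a {b} → b ≡ true → a ∨ b ≡ true
∨-introʳ true  _  = refl
∨-introʳ false b≡ = b≡

∨-elim : ∀ a {b} → a ∨ b ≡ true → a ≡ true ⊎ b ≡ true
∨-elim true  _  = inj₁ refl
∨-elim false b≡ = inj₂ b≡

∧-intro : ∀ {a b} → a ≡ true → b ≡ true → a ∧ b ≡ true
∧-intro refl refl = refl

≟-sound : ∀ {n} {a b : Fin n} → ⌊ a ≟ b ⌋ ≡ true → a ≡ b
≟-sound {a = a} {b} _ with a ≟ b
≟-sound _  | yes a≡b = a≡b
≟-sound () | no _

≟-refl : ∀ {n} (a : Fin n) → ⌊ a ≟ a ⌋ ≡ true
≟-refl a = trans (isYes≗does (a ≟ a)) (dec-true (a ≟ a) refl)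

≟-≢ : ∀ {n} {a b : Fin n} → a ≢ b → ⌊ a ≟ b ⌋ ≡ false
≟-≢ {a = a} {b} a≢b = trans (isYes≗does (a ≟ b)) (dec-false (a ≟ b) a≢b)

-- Counting over finite sets

anyF-intro : ∀ {n} (p : Fin n → Bool) x → p x ≡ true → anyF p ≡ true
anyF-intro p zero    px = ∨-introˡ _ px
anyF-intro p (suc x) px = ∨-introʳ (p zero) (anyF-intro (p ∘ suc) x px)

anyF-elim : ∀ {n} (p : Fin n → Bool) → anyF p ≡ true → ∃ λ x → p x ≡ true
anyF-elim {zero}  p ()
anyF-elim {suc n} p any≡ with ∨-elim (p zero) any≡
... | inj₁ p0   = zero , p0
... | inj₂ rest = let x , px = anyF-elim (p ∘ suc) rest in suc x , px

anyF-cong : ∀ {n} {p q : Fin n → Bool} → (∀ x → p x ≡ q x) → anyF p ≡ anyF q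
anyF-cong {zero}  _  = refl
anyF-cong {suc n} eq = cong₂ _∨_ (eq zero) (anyF-cong (eq ∘ suc))

anyF-permute : ∀ {n} (π : Permutation′ n) (p : Fin n → Bool) → anyF (p ∘ (π ⟨$⟩ʳ_)) ≡ anyF p
anyF-permute π p = ⇔→≡ (mk⇔ to from)
  where
  to : anyF (p ∘ (π ⟨$⟩ʳ_)) ≡ true → anyF p ≡ true
  to any≡ = let _ , px = anyF-elim (p ∘ (π ⟨$⟩ʳ_)) any≡ in anyF-intro p _ px
  from : anyF p ≡ true → anyF (p ∘ (π ⟨$⟩ʳ_)) ≡ true
  from any≡ = let x , px = anyF-elim p any≡ in
    anyF-intro _ (π ⟨$⟩ˡ x) (subst (λ y → p y ≡ true) (sym (inverseʳ π)) px)

indicator : Bool → ℕ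
indicator b = if b then 1 else 0

indicator-≤1 : ∀ b → indicator b ≤ 1
indicator-≤1 true  = ≤-refl
indicator-≤1 false = z≤n

indicator-mono : ∀ {a b} → (a ≡ true → b ≡ true) → indicator a ≤ indicator b
indicator-mono {false} _   = z≤n
indicator-mono {true}  a⇒b rewrite a⇒b refl = ≤-refl

indicator-reflects : ∀ {a b} → indicator a ≡ indicator b → b ≡ true → a ≡ true
indicator-reflects {true}          _  _  = refl
indicator-reflects {false} {true}  () _
indicator-reflects {false} {false} _  ()

_⊆_ : ∀ {n} → (Fin n → Bool) → (Fin n → Bool) → Set
p ⊆ q = ∀ x → p x ≡ true → q x ≡ true

_⊆₂_ : ∀ {m n} → (Fin m → Fin n → Bool) → (Fin m → Fin n → Bool) → Set
R ⊆₂ S = ∀ v → R v ⊆ S v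

countF-cong : ∀ {n} {p q : Fin n → Bool} → (∀ x → p x ≡ q x) → countF p ≡ countF q
countF-cong {zero}  _  = refl
countF-cong {suc n} eq = cong₂ _+_ (cong indicator (eq zero)) (countF-cong (eq ∘ suc))

countF-≤ : ∀ {n} (p : Fin n → Bool) → countF p ≤ n
countF-≤ {zero}  p = z≤n
countF-≤ {suc n} p = +-mono-≤ (indicator-≤1 (p zero)) (countF-≤ (p ∘ suc))

countF-mono : ∀ {n} {p q : Fin n → Bool} → p ⊆ q → countF p ≤ countF q
countF-mono {zero}  _   = z≤n
countF-mono {suc n} p⊆q = +-mono-≤ (indicator-mono (p⊆q zero)) (countF-mono (p⊆q ∘ suc))

countF-pos : ∀ {n} (p : Fin n → Bool) x → p x ≡ true → 0 < countF p
countF-pos p zero    px = ≤-trans (indicator-mono {true} (λ _ → px)) (m≤m+n _ _)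
countF-pos p (suc x) px = ≤-trans (countF-pos (p ∘ suc) x px) (m≤n+m _ _)

countF-empty : ∀ {n} (p : Fin n → Bool) → (∀ x → ¬ p x ≡ true) → countF p ≡ 0
countF-empty {zero}  p _     = refl
countF-empty {suc n} p empty =
  cong₂ _+_ (n≤0⇒n≡0 (indicator-mono {p zero} {false} (⊥-elim ∘ empty zero)))
            (countF-empty (p ∘ suc) (empty ∘ suc))

+-≤-cancelˡ : ∀ {a b c d} → a ≤ c → b ≤ d → a + b ≡ c + d → a ≡ c
+-≤-cancelˡ a≤c b≤d eq with m≤n⇒m<n∨m≡n a≤c
... | inj₁ a<c = ⊥-elim (<-irrefl eq (+-mono-<-≤ a<c b≤d))
... | inj₂ a≡c = a≡c

⊆-countF-≡ : ∀ {n} {p q : Fin n → Bool} → p ⊆ q → countF p ≡ countF q → q ⊆ p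
⊆-countF-≡ {suc n} {p} {q} p⊆q eq = λ where
    zero    → indicator-reflects head≡
    (suc x) → ⊆-countF-≡ (p⊆q ∘ suc) tail≡ x
  where
  head≡ : indicator (p zero) ≡ indicator (q zero)
  head≡ = +-≤-cancelˡ (indicator-mono (p⊆q zero)) (countF-mono (p⊆q ∘ suc)) eq
  tail≡ : countF (p ∘ suc) ≡ countF (q ∘ suc)
  tail≡ = +-cancelˡ-≡ (indicator (q zero)) _ _ (trans (cong (_+ countF (p ∘ suc)) (sym head≡)) eq)

countF-supported : ∀ {n} (p : Fin n → Bool) a {r} →
  (a ≡ true → countF p ≡ r) → (∀ x → p x ≡ true → a ≡ true) → countF p ≡ (if a then r else 0)
countF-supported p true  full _       = full refl
countF-supported p false _    support = countF-empty p (λ x px → case support x px of λ ())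

countF-*-∑ : ∀ {n} (p : Fin n → Bool) r → countF p * r ≡ ∑[ x < n ] (if p x then r else 0)
countF-*-∑ {zero}  p r = refl
countF-*-∑ {suc n} p r =
  trans (head (p zero)) (cong ((if p zero then r else 0) +_) (countF-*-∑ (p ∘ suc) r))
  where
  head : ∀ b {m} → (indicator b + m) * r ≡ (if b then r else 0) + m * r
  head true  = refl
  head false = refl

countF-∑ : ∀ {n} (p : Fin n → Bool) → countF p ≡ ∑[ x < n ] indicator (p x)
countF-∑ p = trans (sym (*-identityʳ _)) (countF-*-∑ p 1)

countF-permute : ∀ {n} (π : Permutation′ n) (p : Fin n → Bool) → countF (p ∘ (π ⟨$⟩ʳ_)) ≡ countF p
countF-permute π p = begin
  countF (p ∘ (π ⟨$⟩ʳ_))            ≡⟨ countF-∑ (p ∘ (π ⟨$⟩ʳ_)) ⟩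
  ∑[ x < _ ] indicator (p (π ⟨$⟩ʳ x)) ≡⟨ ∑-permute (indicator ∘ p) π ⟨
  ∑[ x < _ ] indicator (p x)          ≡⟨ countF-∑ p ⟨
  countF p                            ∎
  where open ≡-Reasoning

∑-countF-comm : ∀ {m n} (R : Fin m → Fin n → Bool) →
  ∑[ v < m ] countF (R v) ≡ ∑[ w < n ] countF (λ v → R v w)
∑-countF-comm {m} {n} R = begin
  ∑[ v < m ] countF (R v)                    ≡⟨ sum-cong-≗ (countF-∑ ∘ R) ⟩
  ∑[ v < m ] ∑[ w < n ] indicator (R v w)    ≡⟨ ∑-comm (λ v w → indicator (R v w)) ⟩
  ∑[ w < n ] ∑[ v < m ] indicator (R v w)    ≡⟨ sum-cong-≗ (λ w → countF-∑ (λ v → R v w)) ⟨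
  ∑[ w < n ] countF (λ v → R v w)            ∎
  where open ≡-Reasoning

double-counting : ∀ {m n} (R : Fin m → Fin n → Bool) {A : Fin m → Bool} {B : Fin n → Bool} {r c} →
  (∀ v w → R v w ≡ true → A v ≡ true × B w ≡ true) →
  (∀ v → A v ≡ true → countF (R v) ≡ r) →
  (∀ w → B w ≡ true → countF (λ v → R v w) ≡ c) →
  countF A * r ≡ countF B * c
double-counting {m} {n} R {A} {B} {r} {c} support row column = begin
  countF A * r                        ≡⟨ countF-*-∑ A r ⟩
  ∑[ v < m ] (if A v then r else 0)   ≡⟨ sum-cong-≗ rows ⟨
  ∑[ v < m ] countF (R v)             ≡⟨ ∑-countF-comm R ⟩
  ∑[ w < n ] countF (λ v → R v w)     ≡⟨ sum-cong-≗ columns ⟩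
  ∑[ w < n ] (if B w then c else 0)   ≡⟨ countF-*-∑ B c ⟨
  countF B * c                        ∎
  where
  open ≡-Reasoning
  rows : ∀ v → countF (R v) ≡ (if A v then r else 0)
  rows v = countF-supported (R v) (A v) (row v) (λ w → proj₁ ∘ support v w)
  columns : ∀ w → countF (λ v → R v w) ≡ (if B w then c else 0)
  columns w = countF-supported _ (B w) (column w) (λ v → proj₂ ∘ support v w)

countF-row-invariant : ∀ {n} (R : Fin n → Fin n → Bool) (π : Permutation′ n) →
  (∀ v w → R (π ⟨$⟩ʳ v) (π ⟨$⟩ʳ w) ≡ R v w) → ∀ a → countF (R (π ⟨$⟩ʳ a)) ≡ countF (R a)
countF-row-invariant R π invariant a =
  trans (sym (countF-permute π (R (π ⟨$⟩ʳ a)))) (countF-cong (invariant a))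

countF-column-invariant : ∀ {n} (R : Fin n → Fin n → Bool) (π : Permutation′ n) →
  (∀ v w → R (π ⟨$⟩ʳ v) (π ⟨$⟩ʳ w) ≡ R v w) →
  ∀ b → countF (λ v → R v (π ⟨$⟩ʳ b)) ≡ countF (λ v → R v b)
countF-column-invariant R π invariant b =
  trans (sym (countF-permute π (λ v → R v (π ⟨$⟩ʳ b)))) (countF-cong (λ v → invariant v b))

monotone-bounded-stalls : ∀ (f : ℕ → ℕ) {B} → (∀ i → f i ≤ f (suc i)) → (∀ i → f i ≤ B) →
  ∃ λ j → f (suc j) ≡ f j
monotone-bounded-stalls f {B} mono bounded =
  fromInj₁ (λ 1+B≤f → ⊥-elim (1+n≰n (≤-trans 1+B≤f (bounded (suc B))))) (climb (suc B))
  where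
  climb : ∀ i → (∃ λ j → f (suc j) ≡ f j) ⊎ i ≤ f i
  climb zero    = inj₂ z≤n
  climb (suc i) with climb i
  ... | inj₁ stall = inj₁ stall
  ... | inj₂ i≤fi with m≤n⇒m<n∨m≡n (mono i)
  ...   | inj₁ grows = inj₂ (≤-trans (s≤s i≤fi) grows)
  ...   | inj₂ stall = inj₁ (i , sym stall)

ascending-chain-stabilises : ∀ {N} (P : ℕ → Fin N → Bool) → (∀ i → P i ⊆ P (suc i)) →
  ∃ λ j → P (suc j) ⊆ P j
ascending-chain-stabilises P ascending =
  let j , stall = monotone-bounded-stalls (countF ∘ P) (countF-mono ∘ ascending) (countF-≤ ∘ P)
  in j , ⊆-countF-≡ (ascending j) (sym stall)

ascending-chain-stabilises₂ : ∀ {m n} (P : ℕ → Fin m → Fin n → Bool) →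
  (∀ i → P i ⊆₂ P (suc i)) → ∃ λ j → P (suc j) ⊆₂ P j
ascending-chain-stabilises₂ {m} {n} P ascending =
  let j , stable = ascending-chain-stabilises flat (λ i x → ascending i _ _)
  in j , λ v w p → trans (sym (flat-combine j v w))
                         (stable (combine v w) (trans (flat-combine (suc j) v w) p))
  where
  flat : ℕ → Fin (m * n) → Bool
  flat i = uncurry (P i) ∘ remQuot n
  flat-combine : ∀ i v w → flat i (combine v w) ≡ P i v w
  flat-combine i v w = cong (uncurry (P i)) (remQuot-combine v w)

-- Distances and 2-geodesics

module _ {n} (Γ : Graph n) where
  open Graph Γ

  Adj⇒≢ : ∀ {u v} → Adj Γ u v → u ≢ v
  Adj⇒≢ {u} uv refl = case trans (sym (irrefl u)) uv of λ ()

  within₁-Adj : ∀ {u v} → Adj Γ u v → within Γ 1 u v ≡ true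
  within₁-Adj {u} {v} uv =
    ∨-introʳ ⌊ u ≟ v ⌋ (anyF-intro (λ x → ⌊ u ≟ x ⌋ ∧ adj x v) u (∧-intro (≟-refl u) uv))

  within₁-elim : ∀ {u v} → within Γ 1 u v ≡ true → u ≡ v ⊎ Adj Γ u v
  within₁-elim {u} {v} w₁ with ∨-elim ⌊ u ≟ v ⌋ w₁
  ... | inj₁ u≟v = inj₁ (≟-sound u≟v)
  ... | inj₂ via with anyF-elim (λ x → ⌊ u ≟ x ⌋ ∧ adj x v) via
  ...   | x , u≟x∧xv =
    inj₂ (subst (λ y → Adj Γ y v) (sym (≟-sound (∧-conicalˡ _ _ u≟x∧xv))) (∧-conicalʳ _ _ u≟x∧xv))

  Adj⇒Dist₁ : ∀ {u v} → Adj Γ u v → Dist Γ 1 u v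
  Adj⇒Dist₁ uv = ∧-intro (within₁-Adj uv) (cong not (≟-≢ (Adj⇒≢ uv)))

  path⇒Dist₂ : ∀ {u v w} → Adj Γ u v → Adj Γ v w → u ≢ w → ¬ Adj Γ u w → Dist Γ 2 u w
  path⇒Dist₂ {u} {v} {w} uv vw u≢w ¬uw = ∧-intro
    (∨-introʳ (within Γ 1 u w)
      (anyF-intro (λ x → within Γ 1 u x ∧ adj x w) v (∧-intro (within₁-Adj uv) vw)))
    (cong not (¬-not λ w₁ → case within₁-elim w₁ of λ where
      (inj₁ u≡w) → u≢w u≡w
      (inj₂ u~w) → ¬uw u~w))

  DiamAtLeast2⇒NonComplete : DiamAtLeast2 Γ → NonComplete Γ
  DiamAtLeast2⇒NonComplete (u , w , far) = u , w , u≢w , ¬uw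
    where
    u≢w : u ≢ w
    u≢w refl = case trans (sym far) (∨-introˡ _ (≟-refl u)) of λ ()
    ¬uw : ¬ Adj Γ u w
    ¬uw uw = case trans (sym far) (within₁-Adj uw) of λ ()

  within-aut : ∀ g → IsAut Γ g → ∀ m a b → within Γ m (g ⟨$⟩ʳ a) (g ⟨$⟩ʳ b) ≡ within Γ m a b
  within-aut g aut zero a b = begin
    ⌊ g ⟨$⟩ʳ a ≟ g ⟨$⟩ʳ b ⌋  ≡⟨ isYes≗does (g ⟨$⟩ʳ a ≟ g ⟨$⟩ʳ b) ⟩
    does (g ⟨$⟩ʳ a ≟ g ⟨$⟩ʳ b) ≡⟨ does-⇔ (mk⇔ injective (cong (g ⟨$⟩ʳ_))) (g ⟨$⟩ʳ a ≟ g ⟨$⟩ʳ b) (a ≟ b) ⟩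
    does (a ≟ b)             ≡⟨ isYes≗does (a ≟ b) ⟨
    ⌊ a ≟ b ⌋                ∎
    where
    open ≡-Reasoning
    injective : g ⟨$⟩ʳ a ≡ g ⟨$⟩ʳ b → a ≡ b
    injective ga≡gb = trans (sym (inverseˡ g)) (trans (cong (g ⟨$⟩ˡ_) ga≡gb) (inverseˡ g))
  within-aut g aut (suc m) a b = cong₂ _∨_ (within-aut g aut m a b) (begin
    anyF (λ x → within Γ m (g ⟨$⟩ʳ a) x ∧ adj x (g ⟨$⟩ʳ b))
      ≡⟨ anyF-permute g (λ x → within Γ m (g ⟨$⟩ʳ a) x ∧ adj x (g ⟨$⟩ʳ b)) ⟨
    anyF (λ x → within Γ m (g ⟨$⟩ʳ a) (g ⟨$⟩ʳ x) ∧ adj (g ⟨$⟩ʳ x) (g ⟨$⟩ʳ b))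
      ≡⟨ anyF-cong (λ x → cong₂ _∧_ (within-aut g aut m a x) (aut x b)) ⟩
    anyF (λ x → within Γ m a x ∧ adj x b) ∎)
    where open ≡-Reasoning

  atDist-aut : ∀ g → IsAut Γ g → ∀ m a b → atDist Γ m (g ⟨$⟩ʳ a) (g ⟨$⟩ʳ b) ≡ atDist Γ m a b
  atDist-aut g aut zero    a b = within-aut g aut zero a b
  atDist-aut g aut (suc m) a b =
    cong₂ (λ x y → x ∧ not y) (within-aut g aut (suc m) a b) (within-aut g aut m a b)

  geodesicᵇ : Fin n → Fin n → Fin n → Bool
  geodesicᵇ u v w = adj u v ∧ adj v w ∧ atDist Γ 2 u w

  path⇒geodesicᵇ : ∀ {u v w} → Adj Γ u v → Adj Γ v w → u ≢ w → ¬ Adj Γ u w → geodesicᵇ u v w ≡ true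
  path⇒geodesicᵇ uv vw u≢w ¬uw = ∧-intro uv (∧-intro vw (path⇒Dist₂ uv vw u≢w ¬uw))

  geodesicᵇ-aut : ∀ g → IsAut Γ g → ∀ u v w →
    geodesicᵇ (g ⟨$⟩ʳ u) (g ⟨$⟩ʳ v) (g ⟨$⟩ʳ w) ≡ geodesicᵇ u v w
  geodesicᵇ-aut g aut u v w = cong₂ _∧_ (aut u v) (cong₂ _∧_ (aut v w) (atDist-aut g aut 2 u w))

  geodesicᵇ-support : ∀ u v w → geodesicᵇ u v w ≡ true → Adj Γ u v × Dist Γ 2 u w
  geodesicᵇ-support u v w geo =
    ∧-conicalˡ (adj u v) _ geo , ∧-conicalʳ (adj v w) _ (∧-conicalʳ (adj u v) _ geo)

  countF-geodesicᵇ-row : ∀ {b₁} → IsB1 Γ b₁ → ∀ {u v} → Adj Γ u v → countF (geodesicᵇ u v) ≡ b₁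
  countF-geodesicᵇ-row isB1 {u} {v} uv =
    trans (countF-cong (λ w → cong (_∧ (adj v w ∧ atDist Γ 2 u w)) uv)) (isB1 u v uv)

  countF-geodesicᵇ-column : ∀ {c₂} → IsC2 Γ c₂ → ∀ {u w} → Dist Γ 2 u w →
    countF (λ v → geodesicᵇ u v w) ≡ c₂
  countF-geodesicᵇ-column isC2 {u} {w} uw = trans (countF-cong reshape) (isC2 u w uw)
    where
    open ≡-Reasoning
    reshape : ∀ v → geodesicᵇ u v w ≡ (adj w v ∧ adj u v)
    reshape v = begin
      adj u v ∧ adj v w ∧ atDist Γ 2 u w  ≡⟨ cong (λ d → adj u v ∧ adj v w ∧ d) uw ⟩
      adj u v ∧ adj v w ∧ true            ≡⟨ cong (adj u v ∧_) (∧-identityʳ (adj v w)) ⟩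
      adj u v ∧ adj v w                   ≡⟨ ∧-comm (adj u v) (adj v w) ⟩
      adj v w ∧ adj u v                   ≡⟨ cong (_∧ adj u v) (symm v w) ⟩
      adj w v ∧ adj u v                   ∎

  geodesic-double-count : ∀ {k b₁ c₂} → Regular Γ k → IsB1 Γ b₁ → IsC2 Γ c₂ →
    ∀ u → k * b₁ ≡ countF (atDist Γ 2 u) * c₂
  geodesic-double-count reg isB1 isC2 u = trans (cong (_* _) (sym (reg u)))
    (double-counting (geodesicᵇ u) (geodesicᵇ-support u)
      (λ v → countF-geodesicᵇ-row isB1) (λ w → countF-geodesicᵇ-column isC2))

-- Orbits of pairs of vertices

_∈_ : ∀ {n} → Permutation′ n → PermGroup n → Set
g ∈ H = PermGroup._∈G H g

stabiliser : ∀ {n} → PermGroup n → Fin n → PermGroup n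
stabiliser G u = record
  { _∈G   = λ g → g ∈G × g ⟨$⟩ʳ u ≡ u
  ; id∈   = id∈ , refl
  ; comp∈ = λ g h (g∈ , gu) (h∈ , hu) → comp∈ g h g∈ h∈ , trans (cong (h ⟨$⟩ʳ_) gu) hu
  ; inv∈  = λ g (g∈ , gu) → inv∈ g g∈ , trans (cong (g ⟨$⟩ˡ_) (sym gu)) (inverseˡ g)
  }
  where open PermGroup G

module PairOrbit {m n} (σ : Fin m → Permutation′ n) (v₀ w₀ : Fin n) where

  reach : ℕ → Fin n → Fin n → Bool
  reach zero    v w = ⌊ v₀ ≟ v ⌋ ∧ ⌊ w₀ ≟ w ⌋
  reach (suc i) v w = reach i v w ∨ anyF (λ t → reach i (σ t ⟨$⟩ʳ v) (σ t ⟨$⟩ʳ w)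
                                              ∨ reach i (σ t ⟨$⟩ˡ v) (σ t ⟨$⟩ˡ w))

  stable : ∃ λ j → reach (suc j) ⊆₂ reach j
  stable = ascending-chain-stabilises₂ reach (λ i v w → ∨-introˡ _)

  orbit : Fin n → Fin n → Bool
  orbit = reach (proj₁ stable)

  orbit-base : orbit v₀ w₀ ≡ true
  orbit-base = reach-base (proj₁ stable)
    where
    reach-base : ∀ i → reach i v₀ w₀ ≡ true
    reach-base zero    = ∧-intro (≟-refl v₀) (≟-refl w₀)
    reach-base (suc i) = ∨-introˡ _ (reach-base i)

  orbit-invariant : ∀ t v w → orbit (σ t ⟨$⟩ʳ v) (σ t ⟨$⟩ʳ w) ≡ orbit v w
  orbit-invariant t v w = ⇔→≡ (mk⇔ backward forward)
    where
    closed : ∀ v w → orbit (σ t ⟨$⟩ʳ v) (σ t ⟨$⟩ʳ w) ∨ orbit (σ t ⟨$⟩ˡ v) (σ t ⟨$⟩ˡ w) ≡ true →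
      orbit v w ≡ true
    closed v w step = proj₂ stable v w (∨-introʳ (orbit v w) (anyF-intro
      (λ t → orbit (σ t ⟨$⟩ʳ v) (σ t ⟨$⟩ʳ w) ∨ orbit (σ t ⟨$⟩ˡ v) (σ t ⟨$⟩ˡ w)) t step))
    backward : orbit (σ t ⟨$⟩ʳ v) (σ t ⟨$⟩ʳ w) ≡ true → orbit v w ≡ true
    backward o = closed v w (∨-introˡ _ o)
    forward : orbit v w ≡ true → orbit (σ t ⟨$⟩ʳ v) (σ t ⟨$⟩ʳ w) ≡ true
    forward o = closed (σ t ⟨$⟩ʳ v) (σ t ⟨$⟩ʳ w) (∨-introʳ (orbit (σ t ⟨$⟩ʳ (σ t ⟨$⟩ʳ v)) _)
      (subst₂ (λ x y → orbit x y ≡ true) (sym (inverseˡ (σ t))) (sym (inverseˡ (σ t))) o))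

  module _ (H : PermGroup n) (σ∈H : ∀ t → σ t ∈ H) where
    open PermGroup H

    Reaches : Fin n → Fin n → Set
    Reaches v w = ∃ λ g → g ∈ H × g ⟨$⟩ʳ v₀ ≡ v × g ⟨$⟩ʳ w₀ ≡ w

    reaches-preimage : ∀ s → s ∈ H → ∀ {v w} → Reaches (s ⟨$⟩ʳ v) (s ⟨$⟩ʳ w) → Reaches v w
    reaches-preimage s s∈ (g , g∈ , gv , gw) =
      g ∘ₚ flip s , comp∈ g (flip s) g∈ (inv∈ s s∈) ,
      trans (cong (s ⟨$⟩ˡ_) gv) (inverseˡ s) , trans (cong (s ⟨$⟩ˡ_) gw) (inverseˡ s)

    reach-sound : ∀ i v w → reach i v w ≡ true → Reaches v w
    reach-sound zero v w r =
      id , id∈ , ≟-sound (∧-conicalˡ ⌊ v₀ ≟ v ⌋ _ r) , ≟-sound (∧-conicalʳ ⌊ v₀ ≟ v ⌋ _ r)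
    reach-sound (suc i) v w r with ∨-elim (reach i v w) r
    ... | inj₁ r′ = reach-sound i v w r′
    ... | inj₂ r′ with anyF-elim (λ t → reach i (σ t ⟨$⟩ʳ v) (σ t ⟨$⟩ʳ w)
                                      ∨ reach i (σ t ⟨$⟩ˡ v) (σ t ⟨$⟩ˡ w)) r′
    ...   | t , r″ with ∨-elim (reach i (σ t ⟨$⟩ʳ v) (σ t ⟨$⟩ʳ w)) r″
    ...     | inj₁ r‴ = reaches-preimage (σ t) (σ∈H t) (reach-sound i _ _ r‴)
    ...     | inj₂ r‴ = reaches-preimage (flip (σ t)) (inv∈ (σ t) (σ∈H t)) (reach-sound i _ _ r‴)

    orbit-sound : ∀ v w → orbit v w ≡ true → Reaches v w
    orbit-sound = reach-sound (proj₁ stable)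

cross-multiplication : ∀ {k d b c x y} → 0 < k → k * x ≡ d * y → k * b ≡ d * c → c * x ≡ b * y
cross-multiplication {k} {d} {b} {c} {x} {y} k>0 kx≡dy kb≡dc =
  *-cancelˡ-≡ (c * x) (b * y) k ⦃ >-nonZero k>0 ⦄ (begin
    k * (c * x)  ≡⟨ *-assoc k c x ⟨
    k * c * x    ≡⟨ cong (_* x) (*-comm k c) ⟩
    c * k * x    ≡⟨ *-assoc c k x ⟩
    c * (k * x)  ≡⟨ cong (c *_) kx≡dy ⟩
    c * (d * y)  ≡⟨ *-assoc c d y ⟨
    c * d * y    ≡⟨ cong (_* y) (*-comm c d) ⟩
    d * c * y    ≡⟨ cong (_* y) kb≡dc ⟨
    k * b * y    ≡⟨ *-assoc k b y ⟩
    k * (b * y)  ∎)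
  where open ≡-Reasoning

coprime-proportion-≤ : ∀ {k d b c x y} → 0 < k → Coprime b c →
  k * x ≡ d * y → k * b ≡ d * c → 0 < x → b ≤ x
coprime-proportion-≤ {k} {d} {b} {c} {x} {y} k>0 cop kx≡dy kb≡dc x>0 = ∣⇒≤ ⦃ >-nonZero x>0 ⦄
  (coprime-divisor cop (divides y (trans c*x≡b*y (*-comm b y))))
  where
  c*x≡b*y : c * x ≡ b * y
  c*x≡b*y = cross-multiplication {k} {d} {b} {c} {x} {y} k>0 kx≡dy kb≡dc

coprime-∣ʳ : ∀ {b k c} → Coprime b k → c ∣ k → Coprime b c
coprime-∣ʳ cop c∣k (d∣b , d∣c) = cop (d∣b , ∣-trans d∣c c∣k)

-- The identity stands in when a or b is not at distance i from u, so that the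
-- transporters form a family indexed by all vertices.
transporter : ∀ {n} (Γ : Graph n) (G : PermGroup n) i → LocallyDistTransitive Γ G i →
  ∀ u a b → ∃ λ g → g ∈ stabiliser G u × (Dist Γ i u a → Dist Γ i u b → g ⟨$⟩ʳ a ≡ b)
transporter Γ G i ldt u a b with atDist Γ i u a in ua | atDist Γ i u b in ub
... | true  | true  = let g , g∈ , gu , ga = ldt u a b ua ub in g , (g∈ , gu) , λ _ _ → ga
... | false | _     = id , (PermGroup.id∈ G , refl) , λ ()
... | true  | false = id , (PermGroup.id∈ G , refl) , λ _ ()

module GeodesicOrbit {n} (Γ : Graph n) (G : PermGroup n) (G≤Aut : SubgroupOfAut Γ G)
  (ldt₁ : LocallyDistTransitive Γ G 1) (ldt₂ : LocallyDistTransitive Γ G 2)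
  (u v₀ w₀ : Fin n) (geo₀ : geodesicᵇ Γ u v₀ w₀ ≡ true) where

  generator : Fin n ⊎ Fin n → Permutation′ n
  generator (inj₁ v) = proj₁ (transporter Γ G 1 ldt₁ u v₀ v)
  generator (inj₂ w) = proj₁ (transporter Γ G 2 ldt₂ u w₀ w)

  generator-∈ : ∀ s → generator s ∈ stabiliser G u
  generator-∈ (inj₁ v) = proj₁ (proj₂ (transporter Γ G 1 ldt₁ u v₀ v))
  generator-∈ (inj₂ w) = proj₁ (proj₂ (transporter Γ G 2 ldt₂ u w₀ w))

  σ : Fin (n + n) → Permutation′ n
  σ = generator ∘ splitAt n

  σ-∈ : ∀ t → σ t ∈ stabiliser G u
  σ-∈ = generator-∈ ∘ splitAt n

  open PairOrbit σ v₀ w₀ public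

  uv₀ : Adj Γ u v₀
  uv₀ = proj₁ (geodesicᵇ-support Γ u v₀ w₀ geo₀)

  uw₀ : Dist Γ 2 u w₀
  uw₀ = proj₂ (geodesicᵇ-support Γ u v₀ w₀ geo₀)

  orbit-⊆-geodesicᵇ : orbit ⊆₂ geodesicᵇ Γ u
  orbit-⊆-geodesicᵇ v w o with orbit-sound (stabiliser G u) σ-∈ v w o
  ... | g , (g∈ , gu) , refl , refl = subst (λ x → geodesicᵇ Γ x (g ⟨$⟩ʳ v₀) (g ⟨$⟩ʳ w₀) ≡ true) gu
    (trans (geodesicᵇ-aut Γ g (G≤Aut g g∈) u v₀ w₀) geo₀)

  orbit-row : ∀ {v} → Adj Γ u v → countF (orbit v) ≡ countF (orbit v₀)
  orbit-row {v} uv = subst (λ x → countF (orbit x) ≡ countF (orbit v₀)) σv₀≡v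
    (countF-row-invariant orbit (σ (v ↑ˡ n)) (orbit-invariant (v ↑ˡ n)) v₀)
    where
    σv₀≡v : σ (v ↑ˡ n) ⟨$⟩ʳ v₀ ≡ v
    σv₀≡v rewrite splitAt-↑ˡ n v n =
      proj₂ (proj₂ (transporter Γ G 1 ldt₁ u v₀ v)) (Adj⇒Dist₁ Γ uv₀) (Adj⇒Dist₁ Γ uv)

  orbit-column : ∀ {w} → Dist Γ 2 u w → countF (λ v → orbit v w) ≡ countF (λ v → orbit v w₀)
  orbit-column {w} uw = subst (λ x → countF (λ v → orbit v x) ≡ countF (λ v → orbit v w₀)) σw₀≡w
    (countF-column-invariant orbit (σ (n ↑ʳ w)) (orbit-invariant (n ↑ʳ w)) w₀)
    where
    σw₀≡w : σ (n ↑ʳ w) ⟨$⟩ʳ w₀ ≡ w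
    σw₀≡w rewrite splitAt-↑ʳ n n w = proj₂ (proj₂ (transporter Γ G 2 ldt₂ u w₀ w)) uw₀ uw

  orbit-double-count : ∀ {k} → Regular Γ k →
    k * countF (orbit v₀) ≡ countF (atDist Γ 2 u) * countF (λ v → orbit v w₀)
  orbit-double-count reg = trans (cong (_* _) (sym (reg u)))
    (double-counting orbit (λ v w → geodesicᵇ-support Γ u v w ∘ orbit-⊆-geodesicᵇ v w)
      (λ v → orbit-row) (λ w → orbit-column))

  geodesicᵇ-⊆-orbit : ∀ {k b₁ c₂} → Regular Γ k → 0 < k → IsB1 Γ b₁ → IsC2 Γ c₂ → Coprime b₁ c₂ →
    geodesicᵇ Γ u v₀ ⊆ orbit v₀
  geodesicᵇ-⊆-orbit {b₁ = b₁} reg k>0 isB1 isC2 cop =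
    ⊆-countF-≡ (orbit-⊆-geodesicᵇ v₀) (trans m₁≡b₁ (sym row))
    where
    row : countF (geodesicᵇ Γ u v₀) ≡ b₁
    row = countF-geodesicᵇ-row Γ isB1 uv₀
    m₁≡b₁ : countF (orbit v₀) ≡ b₁
    m₁≡b₁ = ≤-antisym
      (subst (countF (orbit v₀) ≤_) row (countF-mono (orbit-⊆-geodesicᵇ v₀)))
      (coprime-proportion-≤ {d = countF (atDist Γ 2 u)} k>0 cop
        (orbit-double-count reg) (geodesic-double-count Γ reg isB1 isC2 u)
        (countF-pos (orbit v₀) w₀ orbit-base))

-- Transitivity on 2-geodesics

module _ {n} (Γ : Graph n) (G : PermGroup n) (G≤Aut : SubgroupOfAut Γ G) where
  open PermGroup G

  arc-transitive : VertexTransitive Γ G → LocallyDistTransitive Γ G 1 → ArcTransitive Γ G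
  arc-transitive vt ldt₁ u v u′ v′ uv u′v′ =
    let g , g∈ , gu = vt u u′
        u′gv : Adj Γ u′ (g ⟨$⟩ʳ v)
        u′gv = subst (λ x → Adj Γ x (g ⟨$⟩ʳ v)) gu (trans (G≤Aut g g∈ u v) uv)
        h , h∈ , hu′ , hgv = ldt₁ u′ (g ⟨$⟩ʳ v) v′ (Adj⇒Dist₁ Γ u′gv) (Adj⇒Dist₁ Γ u′v′)
    in g ∘ₚ h , comp∈ g h g∈ h∈ , trans (cong (h ⟨$⟩ʳ_) gu) hu′ , hgv

  geodesic-stabiliser-transitive : LocallyDistTransitive Γ G 1 → LocallyDistTransitive Γ G 2 →
    ∀ {k b₁ c₂} → Regular Γ k → 0 < k → IsB1 Γ b₁ → IsC2 Γ c₂ → Coprime b₁ c₂ →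
    ∀ u v w w′ → geodesicᵇ Γ u v w ≡ true → geodesicᵇ Γ u v w′ ≡ true →
    ∃ λ g → g ∈G × g ⟨$⟩ʳ u ≡ u × g ⟨$⟩ʳ v ≡ v × g ⟨$⟩ʳ w ≡ w′
  geodesic-stabiliser-transitive ldt₁ ldt₂ reg k>0 isB1 isC2 cop u v w w′ geo geo′ =
    let g , (g∈ , gu) , gv , gw = orbit-sound (stabiliser G u) σ-∈ v w′
                                    (geodesicᵇ-⊆-orbit reg k>0 isB1 isC2 cop w′ geo′)
    in g , g∈ , gu , gv , gw
    where open GeodesicOrbit Γ G G≤Aut ldt₁ ldt₂ u v w geo

  two-geodesic-transitive : TwoDistanceTransitive Γ G →
    ∀ {k b₁ c₂} → Regular Γ k → 0 < k → IsB1 Γ b₁ → IsC2 Γ c₂ → Coprime b₁ c₂ →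
    TwoGeodesicTransitive Γ G
  two-geodesic-transitive (diam , vt , ldt₁ , ldt₂) reg k>0 isB1 isC2 cop =
    arc , DiamAtLeast2⇒NonComplete Γ diam , geodesic-transitive
    where
    arc : ArcTransitive Γ G
    arc = arc-transitive vt ldt₁
    geodesic-transitive : ∀ u v w u′ v′ w′ → Geodesic2 Γ G u v w → Geodesic2 Γ G u′ v′ w′ →
      ∃ λ g → g ∈G × g ⟨$⟩ʳ u ≡ u′ × g ⟨$⟩ʳ v ≡ v′ × g ⟨$⟩ʳ w ≡ w′
    geodesic-transitive u v w u′ v′ w′ (uv , vw , u≢w , ¬uw) (u′v′ , v′w′ , u′≢w′ , ¬u′w′) =
      let g , g∈ , gu , gv = arc u v u′ v′ uv u′v′
          geo : geodesicᵇ Γ u′ v′ (g ⟨$⟩ʳ w) ≡ true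
          geo = subst₂ (λ x y → geodesicᵇ Γ x y (g ⟨$⟩ʳ w) ≡ true) gu gv
                  (trans (geodesicᵇ-aut Γ g (G≤Aut g g∈) u v w) (path⇒geodesicᵇ Γ uv vw u≢w ¬uw))
          h , h∈ , hu′ , hv′ , hgw = geodesic-stabiliser-transitive ldt₁ ldt₂ reg k>0 isB1 isC2 cop
                                       u′ v′ (g ⟨$⟩ʳ w) w′ geo (path⇒geodesicᵇ Γ u′v′ v′w′ u′≢w′ ¬u′w′)
      in g ∘ₚ h , comp∈ g h g∈ h∈ , trans (cong (h ⟨$⟩ʳ_) gu) hu′ , trans (cong (h ⟨$⟩ʳ_) gv) hv′ , hgw

lemma5p5 : ∀ (n : ℕ) (Γ : Graph n) (G : PermGroup n) (k b₁ c₂ : ℕ) →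
    Connected Γ → Regular Γ k → 2 ≤ k →
    SubgroupOfAut Γ G → TwoDistanceTransitive Γ G →
    IsB1 Γ b₁ → IsC2 Γ c₂ →
    ((gcd b₁ k ≡ 1 → c₂ ∣ k → TwoGeodesicTransitive Γ G) ×
     (gcd b₁ k ≡ 1 → gcd b₁ c₂ ≡ 1 → TwoGeodesicTransitive Γ G))
lemma5p5 n Γ G k b₁ c₂ _ reg 2≤k G≤Aut tdt isB1 isC2 =
  (λ gcd[b₁,k]≡1 c₂∣k → from-coprime (coprime-∣ʳ (gcd≡1⇒coprime gcd[b₁,k]≡1) c₂∣k)) ,
  (λ _ gcd[b₁,c₂]≡1 → from-coprime (gcd≡1⇒coprime gcd[b₁,c₂]≡1))
  where
  from-coprime : Coprime b₁ c₂ → TwoGeodesicTransitive Γ G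
  from-coprime = two-geodesic-transitive Γ G G≤Aut tdt reg (≤-trans (s≤s z≤n) 2≤k) isB1 isC2
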